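{- Let $G=(V,E)$ be a finite graph and $e\in E$. Then $$\gamma_{coe}(G)-2\leq \gamma_{coe}(G-e)\leq \gamma_{coe}(G)+2.$$
   Context: All graphs are finite, without loops and without directed edges. For a graph $H=(V,E)$, a set $D\subseteq V$ is a dominating set if every vertex in $V\setminus D$ is adjacent to at least one vertex of $D$. A dominating set $D$ is a co-even dominating set if every vertex $u\in V\setminus D$ has even degree in $H$. The co-even domination number $\gamma_{coe}(H)$ is the minimum cardinality of a co-even dominating set of $H$. The graph $G-e$ is obtained from $G$ by removing the edge $e$ (keeping all vertices). -}

module Defs where

open import Data.Nat using (ℕ; _+_; _*_)
open import Data.Bool using (Bool; true; false; if_then_else_; _∧_; _∨_)
open import Data.Bool.Properties using (∨-comm)
open import Data.Fin using (Fin; _≟_)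
open import Data.Fin.Subset using (Subset; _∈_; _∉_; ∣_∣)
open import Data.List using (List; length; filter; allFin)
open import Data.Product using (Σ; ∃; _×_; _,_)
open import Relation.Nullary.Decidable using (⌊_⌋)
open import Relation.Binary.PropositionalEquality using (_≡_; refl; cong)

record Graph (n : ℕ) : Set where
  field
    adj    : Fin n → Fin n → Bool
    sym    : ∀ i j → adj i j ≡ adj j i
    irrefl : ∀ i → adj i i ≡ false
open Graph public

-- An edge of G: an (ordered representative of an) unordered pair {u,v} with u ~ v.
Edge : ∀ {n} → Graph n → Set
Edge {n} G = Σ (Fin n) λ u → Σ (Fin n) λ v → adj G u v ≡ true

degree : ∀ {n} → Graph n → Fin n → ℕ
degree {n} G u = length (filter (λ v → adj G u v Data.Bool.≟ true) (allFin n))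

Even : ℕ → Set
Even m = ∃ λ k → m ≡ 2 * k

samePair : ∀ {n} → Fin n → Fin n → Fin n → Fin n → Bool
samePair u v i j = (⌊ i ≟ u ⌋ ∧ ⌊ j ≟ v ⌋) ∨ (⌊ i ≟ v ⌋ ∧ ⌊ j ≟ u ⌋)

private
  samePair-sym : ∀ {n} (u v i j : Fin n) → samePair u v i j ≡ samePair u v j i
  samePair-sym u v i j with ⌊ i ≟ u ⌋ | ⌊ j ≟ v ⌋ | ⌊ i ≟ v ⌋ | ⌊ j ≟ u ⌋
  ... | a | b | c | d = aux a b c d
    where
    aux : ∀ a b c d → (a ∧ b) ∨ (c ∧ d) ≡ (d ∧ c) ∨ (b ∧ a)
    aux false false false false = refl
    aux false false false true = refl
    aux false false true false = refl
    aux false false true true = refl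
    aux false true false false = refl
    aux false true false true = refl
    aux false true true false = refl
    aux false true true true = refl
    aux true false false false = refl
    aux true false false true = refl
    aux true false true false = refl
    aux true false true true = refl
    aux true true false false = refl
    aux true true false true = refl
    aux true true true false = refl
    aux true true true true = refl

removeEdge : ∀ {n} (G : Graph n) → Edge G → Graph n
removeEdge G (u , v , _) = record
  { adj    = λ i j → if samePair u v i j then false else adj G i j
  ; sym    = λ i j → helper i j
  ; irrefl = λ i → helper2 i
  }
  where
  helper : ∀ i j → (if samePair u v i j then false else adj G i j)
                 ≡ (if samePair u v j i then false else adj G j i)
  helper i j rewrite samePair-sym u v i j | sym G i j = refl
  helper2 : ∀ i → (if samePair u v i i then false else adj G i i) ≡ false
  helper2 i with samePair u v i i
  ... | true = refl
  ... | false = irrefl G i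

IsDominating : ∀ {n} → Graph n → Subset n → Set
IsDominating {n} G D = ∀ (u : Fin n) → u ∉ D → ∃ λ v → v ∈ D × adj G u v ≡ true

IsCoEvenDominating : ∀ {n} → Graph n → Subset n → Set
IsCoEvenDominating {n} G D =
  IsDominating G D × (∀ (u : Fin n) → u ∉ D → Even (degree G u))

IsCoEvenDominationNumber : ∀ {n} → Graph n → ℕ → Set
IsCoEvenDominationNumber {n} G k =
  (∃ λ D → IsCoEvenDominating G D × ∣ D ∣ ≡ k) ×
  (∀ D → IsCoEvenDominating G D → k Data.Nat.≤ ∣ D ∣)

-- Two graphs whose adjacency rows agree outside a vertex set S transfer co-even
-- dominating sets: if D works for one, then D ∪ S works for the other, since every
-- vertex outside D ∪ S has the same neighbours and the same degree in both graphs.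
-- G and G - e agree outside the two ends of e, so the domination numbers differ by
-- at most two in either direction.
module Submission where

open import Defs hiding (sym)
open import Data.Bool using (true) renaming (_≟_ to _≟ᵇ_)
open import Data.Fin using (Fin; _≟_)
open import Data.Fin.Subset using (Subset; _∪_; ⁅_⁆; _∉_; ∣_∣; outside; inside)
open import Data.Fin.Subset.Properties
  using (p⊆p∪q; q⊆p∪q; x∉⁅y⁆⇒x≢y; ∣⁅x⁆∣≡1)
open import Data.List using (length; allFin)
open import Data.List.Properties using (filter-≐)
open import Data.Nat using (ℕ; _+_; _≤_; s≤s)
open import Data.Nat.Properties using (≤-refl; ≤-trans; ≤-reflexive; n≤1+n; +-monoʳ-≤; +-suc; module ≤-Reasoning)
open import Data.Product using (_×_; _,_)
open import Data.Vec using (_∷_; [])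
open import Relation.Binary.PropositionalEquality
  using (_≡_; refl; sym; trans; cong; cong₂)
open import Relation.Nullary using (yes; no; contradiction)

∣p∪q∣≤∣p∣+∣q∣ : ∀ {n} (p q : Subset n) → ∣ p ∪ q ∣ ≤ ∣ p ∣ + ∣ q ∣
∣p∪q∣≤∣p∣+∣q∣ []            []            = ≤-refl
∣p∪q∣≤∣p∣+∣q∣ (outside ∷ p) (outside ∷ q) = ∣p∪q∣≤∣p∣+∣q∣ p q
∣p∪q∣≤∣p∣+∣q∣ (outside ∷ p) (inside  ∷ q) =
  ≤-trans (s≤s (∣p∪q∣≤∣p∣+∣q∣ p q)) (≤-reflexive (sym (+-suc ∣ p ∣ ∣ q ∣)))
∣p∪q∣≤∣p∣+∣q∣ (inside  ∷ p) (outside ∷ q) = s≤s (∣p∪q∣≤∣p∣+∣q∣ p q)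
∣p∪q∣≤∣p∣+∣q∣ (inside  ∷ p) (inside  ∷ q) =
  s≤s (≤-trans (∣p∪q∣≤∣p∣+∣q∣ p q) (+-monoʳ-≤ ∣ p ∣ (n≤1+n ∣ q ∣)))

∣⁅x⁆∪⁅y⁆∣≤2 : ∀ {n} (x y : Fin n) → ∣ ⁅ x ⁆ ∪ ⁅ y ⁆ ∣ ≤ 2
∣⁅x⁆∪⁅y⁆∣≤2 x y = begin
  ∣ ⁅ x ⁆ ∪ ⁅ y ⁆ ∣     ≤⟨ ∣p∪q∣≤∣p∣+∣q∣ ⁅ x ⁆ ⁅ y ⁆ ⟩
  ∣ ⁅ x ⁆ ∣ + ∣ ⁅ y ⁆ ∣ ≡⟨ cong₂ _+_ (∣⁅x⁆∣≡1 x) (∣⁅x⁆∣≡1 y) ⟩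
  2                     ∎
  where open ≤-Reasoning

SameRowsOutside : ∀ {n} → Graph n → Graph n → Subset n → Set
SameRowsOutside {n} G H S = ∀ (w : Fin n) → w ∉ S → ∀ x → adj G w x ≡ adj H w x

sameRowsOutside-sym : ∀ {n} {G H : Graph n} {S : Subset n} →
  SameRowsOutside G H S → SameRowsOutside H G S
sameRowsOutside-sym same w w∉S x = sym (same w w∉S x)

degree-cong : ∀ {n} (G H : Graph n) (w : Fin n) →
  (∀ x → adj G w x ≡ adj H w x) → degree G w ≡ degree H w
degree-cong {n} G H w same = cong length
  (filter-≐ (λ x → adj G w x ≟ᵇ true) (λ x → adj H w x ≟ᵇ true)
    ((λ {x} p → trans (sym (same x)) p) , (λ {x} p → trans (same x) p))
    (allFin n))

∪-coEvenDominating : ∀ {n} (G H : Graph n) (S : Subset n) →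
  SameRowsOutside G H S → ∀ D → IsCoEvenDominating H D → IsCoEvenDominating G (D ∪ S)
∪-coEvenDominating G H S same D (dominating , coEven) = dominating′ , coEven′
  where
  ∉D : ∀ {w} → w ∉ D ∪ S → w ∉ D
  ∉D w∉D∪S w∈D = w∉D∪S (p⊆p∪q S w∈D)
  ∉S : ∀ {w} → w ∉ D ∪ S → w ∉ S
  ∉S w∉D∪S w∈S = w∉D∪S (q⊆p∪q D S w∈S)

  dominating′ : IsDominating G (D ∪ S)
  dominating′ w w∉D∪S with dominating w (∉D w∉D∪S)
  ... | x , x∈D , w~x = x , p⊆p∪q S x∈D , trans (same w (∉S w∉D∪S) x) w~x

  coEven′ : ∀ w → w ∉ D ∪ S → Even (degree G w)
  coEven′ w w∉D∪S with coEven w (∉D w∉D∪S)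
  ... | k , deg≡2k = k , trans (degree-cong G H w (same w (∉S w∉D∪S))) deg≡2k

coEvenDominationNumber-≤-+ : ∀ {n} (G H : Graph n) (S : Subset n) {k k′ : ℕ} →
  SameRowsOutside G H S →
  IsCoEvenDominationNumber G k → IsCoEvenDominationNumber H k′ → k ≤ k′ + ∣ S ∣
coEvenDominationNumber-≤-+ G H S same (_ , minimalG) ((D , coEvenD , refl) , _) =
  ≤-trans (minimalG (D ∪ S) (∪-coEvenDominating G H S same D coEvenD))
          (∣p∪q∣≤∣p∣+∣q∣ D S)

removeEdge-sameRowsOutside : ∀ {n} (G : Graph n) (u v : Fin n) (u~v : adj G u v ≡ true) →
  SameRowsOutside (removeEdge G (u , v , u~v)) G (⁅ u ⁆ ∪ ⁅ v ⁆)
removeEdge-sameRowsOutside G u v _ w w∉uv x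
  with w ≟ u | w ≟ v
... | yes w≡u | _       = contradiction w≡u (x∉⁅y⁆⇒x≢y (λ w∈u → w∉uv (p⊆p∪q ⁅ v ⁆ w∈u)))
... | no _    | yes w≡v = contradiction w≡v (x∉⁅y⁆⇒x≢y (λ w∈v → w∉uv (q⊆p∪q ⁅ u ⁆ ⁅ v ⁆ w∈v)))
... | no _    | no _    = refl

theorem2p6 : ∀ {n} (G : Graph n) (e : Edge G) (k k′ : ℕ) →
    IsCoEvenDominationNumber G k →
    IsCoEvenDominationNumber (removeEdge G e) k′ →
    k ≤ k′ + 2 × k′ ≤ k + 2
theorem2p6 G e@(u , v , u~v) k k′ γG γG-e =
    ≤-trans (coEvenDominationNumber-≤-+ G (removeEdge G e) ends same′ γG γG-e)
            (+-monoʳ-≤ k′ ends≤2)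
  , ≤-trans (coEvenDominationNumber-≤-+ (removeEdge G e) G ends same γG-e γG)
            (+-monoʳ-≤ k ends≤2)
  where
  ends : Subset _
  ends = ⁅ u ⁆ ∪ ⁅ v ⁆
  same : SameRowsOutside (removeEdge G e) G ends
  same = removeEdge-sameRowsOutside G u v u~v
  same′ : SameRowsOutside G (removeEdge G e) ends
  same′ = sameRowsOutside-sym {G = removeEdge G e} {H = G} same
  ends≤2 : ∣ ends ∣ ≤ 2
  ends≤2 = ∣⁅x⁆∪⁅y⁆∣≤2 u v
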